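{- Let $m\ne 1$ be an odd positive integer, not divisible by $31$, with no prime factor in $\mathcal{P}_0$, and let $\omega_j=\omega_j(m)$ ($1\le j\le5$), $\omega=\omega_1+\dots+\omega_5$. For $j\in\mathbb{Z}$ let $$T(m,j)=\sum_{\substack{d\mid \overline{m}\\ \ell(d)\equiv j \pmod 6}}\mu(d),$$ where $\overline{m}=\prod_{p\mid m}p$ and $\mu$ is the Möbius function. Then $$T(m,j)=2^{\omega_3-1}3^{\lceil\frac{\omega_2+\omega_4}{2}-1\rceil}v_{\alpha(m)-2j}+\frac{0^{\omega_3}}{2}3^{\lceil\frac{\omega}{2}-1\rceil}v_{a(m)-4j}+0^{\omega_2+\omega_4}\frac{(-1)^j}{3}2^{\omega-1}.$$
   Context: For $n$ not divisible by $31$, $\ell(n)\in\mathbb{Z}/6\mathbb{Z}$ is the unique $j$ such that $n\equiv 2^k3^j\pmod{31}$ for some $k\in\{0,\dots,4\}$ (so $\ell(1)=0$). For $0\le j\le5$, $\mathcal{P}_j$ is the set of odd primes $p\ne31$ with $\ell(p)=j$, and $\omega_j(n)$ is the number of distinct prime divisors of $n$ in $\mathcal{P}_j$. $\alpha(m)=2\omega_5-2\omega_1+\omega_4-\omega_2\bmod 12$, $a(m)=\omega_5-\omega_1+\omega_2-\omega_4\bmod 12$. $(v_i)_{i\in\mathbb{Z}}$ is the $12$-periodic sequence with $v_i=\frac{2}{\sqrt3}\cos(i\pi/6)$ for odd $i$ and $v_i=2\cos(i\pi/6)$ for even $i$, i.e. $(v_0,\dots,v_{11})=(2,1,1,0,-1,-1,-2,-1,-1,0,1,1)$.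 Convention: $0^0=1$, $0^\omega=0$ for $\omega>0$. -}

module Defs where

open import Data.Bool using (Bool; true; false; if_then_else_)
open import Data.Nat as ℕ using (ℕ; zero; suc; _≡ᵇ_; NonZero)
open import Data.Nat.Properties using (m^n≢0)
open import Data.Nat.Divisibility using (_∣_; _∣?_)
open import Data.Nat.Primality using (Prime; prime?)
open import Data.Integer as ℤ using (ℤ; +_; -[1+_]; _%ℕ_)
open import Data.Rational as ℚ using (ℚ; 0ℚ; 1ℚ; ceiling)
open import Data.List using (List; []; _∷_; filter; upTo; map; foldr; length)
open import Data.Bool.ListAction using (any)
open import Data.Nat.ListAction using (product)
open import Data.Product using (_×_)
open import Relation.Nullary using (¬_; Dec)
open import Relation.Nullary.Decidable using (_×-dec_; ¬?)
open import Relation.Binary.PropositionalEquality using (_≡_; _≢_)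

-- ℓ(n) : for n not divisible by 31, the unique j ∈ {0,…,5} such that
-- n ≡ 2^k 3^j (mod 31) for some k ∈ {0,…,4}. (Computed by search over
-- j = 0,…,5; the value for 31 ∣ n is irrelevant and never used.)

matchesℓ : ℕ → ℕ → Bool
matchesℓ j n = any (λ k → ((2 ℕ.^ k ℕ.* 3 ℕ.^ j) ℕ.% 31) ≡ᵇ (n ℕ.% 31)) (upTo 5)

ℓ : ℕ → ℕ
ℓ n = go (upTo 6)
  where
  go : List ℕ → ℕ
  go []       = 0
  go (j ∷ js) = if matchesℓ j n then j else go js

InP : ℕ → ℕ → Set
InP j p = Prime p × (¬ 2 ∣ p) × (p ≢ 31) × (ℓ p ≡ j)

InP? : ∀ j p → Dec (InP j p)
InP? j p = prime? p ×-dec ¬? (2 ∣? p) ×-dec ¬? (p ℕ.≟ 31) ×-dec (ℓ p ℕ.≟ j)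

primeDivisors : ℕ → List ℕ
primeDivisors n = filter (λ p → prime? p ×-dec (p ∣? n)) (upTo (suc n))

ω : ℕ → ℕ → ℕ
ω j n = length (filter (InP? j) (primeDivisors n))

rad : ℕ → ℕ
rad m = product (primeDivisors m)

divisors : ℕ → List ℕ
divisors n = filter (_∣? n) (upTo (suc n))

μ : ℕ → ℤ
μ d = if any (λ p → Data.Bool._∧_ (Relation.Nullary.does (prime? p))
                                  (Relation.Nullary.does ((p ℕ.* p) ∣? d)))
             (upTo (suc d))
      then + 0
      else (ℤ.- (+ 1)) ℤ.^ length (primeDivisors d)
  where import Data.Bool; import Relation.Nullary

sumℤ : List ℤ → ℤ
sumℤ = foldr ℤ._+_ (+ 0)

T : ℕ → ℤ → ℤ
T m j = sumℤ (map μ (filter (λ d → ℓ d ℕ.≟ (j %ℕ 6)) (divisors (rad m))))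

αm : ℕ → ℤ
αm m = (+ 2) ℤ.* + ω 5 m ℤ.- (+ 2) ℤ.* + ω 1 m ℤ.+ + ω 4 m ℤ.- + ω 2 m

am : ℕ → ℤ
am m = + ω 5 m ℤ.- + ω 1 m ℤ.+ + ω 2 m ℤ.- + ω 4 m

vTable : ℕ → ℤ
vTable 0  = + 2
vTable 1  = + 1
vTable 2  = + 1
vTable 3  = + 0
vTable 4  = ℤ.- (+ 1)
vTable 5  = ℤ.- (+ 1)
vTable 6  = ℤ.- (+ 2)
vTable 7  = ℤ.- (+ 1)
vTable 8  = ℤ.- (+ 1)
vTable 9  = + 0
vTable 10 = + 1
vTable _  = + 1

v : ℤ → ℤ
v i = vTable (i %ℕ 12)

toℚ : ℤ → ℚ
toℚ z = z ℚ./ 1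

-- natural power in ℚ (so 0 ^ 0 = 1, 0 ^ (suc n) = 0)
_^ℚ_ : ℚ → ℕ → ℚ
q ^ℚ zero  = 1ℚ
q ^ℚ suc n = q ℚ.* (q ^ℚ n)

powℤ : (b : ℕ) → .{{NonZero b}} → ℤ → ℚ
powℤ b (+ n)    = ((+ b) ℚ./ 1) ^ℚ n
powℤ b -[1+ n ] = (+ 1) ℚ./ (b ℕ.^ suc n)
  where instance _ = m^n≢0 b (suc n)

signPow : ℤ → ℚ
signPow j = if (j %ℕ 2) ≡ᵇ 0 then 1ℚ else ℚ.- 1ℚ

RHS : ℕ → ℤ → ℚ
RHS m j =
    powℤ 2 (+ w3 ℤ.- + 1)
      ℚ.* powℤ 3 (ceiling ((+ (w2 ℕ.+ w4)) ℚ./ 2 ℚ.- 1ℚ))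
      ℚ.* toℚ (v (αm m ℤ.- (+ 2) ℤ.* j))
  ℚ.+ (0ℚ ^ℚ w3) ℚ.* ((+ 1) ℚ./ 2)
      ℚ.* powℤ 3 (ceiling ((+ w) ℚ./ 2 ℚ.- 1ℚ))
      ℚ.* toℚ (v (am m ℤ.- (+ 4) ℤ.* j))
  ℚ.+ (0ℚ ^ℚ (w2 ℕ.+ w4)) ℚ.* signPow j ℚ.* ((+ 1) ℚ./ 3)
      ℚ.* powℤ 2 (+ w ℤ.- + 1)
  where
  w2 = ω 2 m
  w3 = ω 3 m
  w4 = ω 4 m
  w  = ω 1 m ℕ.+ ω 2 m ℕ.+ ω 3 m ℕ.+ ω 4 m ℕ.+ ω 5 m

-- Write m̄ = p·N with p prime. The divisors of m̄ are those of N together with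
-- their multiples by p, μ(pd) = −μ(d) and ℓ(pd) ≡ ℓ(p) + ℓ(d) (mod 6), so
-- T(pN, j) = T(N, j) − T(N, j − ℓ(p)). Over ℤ, six times the right-hand side,
-- plus the term 0^ω needed for m̄ = 1, satisfies the same recursion for each
-- class ℓ(p) ∈ {1, …, 5}; this reduces to finitely many identities between the
-- 12-periodic sequence v and (−1)^j. Both sides agree for m̄ = 1, so induction
-- over the prime factors of m gives 6·T = 6·RHS.

module Submission where

open import Defs
open import Algebra.Bundles using (CommutativeMonoid)
open import Data.Bool using (Bool; true; false; if_then_else_; _∧_)
import Data.Bool as Bool
open import Data.Bool.ListAction using (any)
open import Data.Empty using (⊥; ⊥-elim)
open import Data.Integer as ℤ using (ℤ; +_; -[1+_]; _%ℕ_; _/ℕ_; _⊖_; ∣_∣)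
import Data.Integer.Properties as ℤ
open import Algebra.Properties.Ring ℤ.+-*-ring using (+-cancelˡ)
open import Data.Integer.DivMod using (a≡a%ℕn+[a/ℕn]*n; n%ℕd<d; div-pos-is-/ℕ)
open import Data.Integer.Tactic.RingSolver using (solve-∀)
open import Data.List using (List; []; _∷_; _++_; map; filter; upTo; length)
open import Data.List.Properties using (map-++; map-∘; map-cong-local)
open import Data.List.Membership.Propositional using (_∈_; lose)
open import Data.List.Membership.Propositional.Properties
open import Data.List.Membership.Propositional.Properties.WithK using (unique∧set⇒bag)
open import Data.List.Relation.Binary.BagAndSetEquality using (∼bag⇒↭)
open import Data.List.Relation.Binary.Permutation.Propositional using (_↭_; ↭⇒↭ₛ)
import Data.List.Relation.Binary.Permutation.Propositional.Properties as ↭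
open import Data.List.Relation.Binary.Permutation.Setoid.Properties using (foldr-commMonoid)
open import Data.List.Relation.Unary.All as All using (All; all?; _∷_)
open import Data.List.Relation.Unary.AllPairs using (_∷_)
open import Data.List.Relation.Unary.Any using (here; there; satisfied)
open import Data.List.Relation.Unary.Any.Properties using (any⁺; any⁻)
open import Data.List.Relation.Unary.Unique.Propositional using (Unique)
import Data.List.Relation.Unary.Unique.Propositional.Properties as Unique
open import Data.Nat as ℕ using (ℕ; zero; suc; NonZero; _<_; s≤s; _≡ᵇ_; ⌈_/2⌉; ⌊_/2⌋)
import Data.Nat.Properties as ℕ
import Data.Nat.DivMod as ℕ
open import Data.Nat.Coprimality as Coprime using (Coprime)
open import Data.Nat.Divisibility
open import Data.Nat.ListAction using (product)
open import Data.Nat.Primality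
open import Data.Nat.Primality.Factorisation using (factorise; factorisationHasAllPrimeFactors)
open import Data.Product using (_×_; _,_; proj₁; proj₂; ∃-syntax)
open import Data.Rational as ℚ using (ℚ; mkℚ; 0ℚ; 1ℚ; ceiling)
import Data.Rational.Properties as ℚ
import Data.Rational.Solver as ℚ-Solver
open import Data.Rational.Unnormalised as ℚᵘ using (mkℚᵘ; *≡*)
import Data.Rational.Unnormalised.Properties as ℚᵘ
open import Data.Sum using (inj₁; inj₂; [_,_])
open import Function.Bundles using (_⇔_; mk⇔)
import Function.Properties.Equivalence as ⇔
open import Level using (0ℓ)
open import Relation.Nullary using (¬_; yes; no; does)
open import Relation.Nullary.Decidable using (True; toWitness; _×-dec_; _→-dec_; ¬?; does-⇔; T?)
open import Relation.Unary using (Pred; Decidable)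
open import Relation.Binary.PropositionalEquality using (_≡_; _≢_; refl; sym; trans; cong; cong₂; subst; module ≡-Reasoning)

-- Residues modulo n

residue-unique : ∀ {n r s} (q p : ℤ) → r < n → s < n →
                 + r ℤ.+ q ℤ.* + n ≡ + s ℤ.+ p ℤ.* + n → r ≡ s
residue-unique {n} {r} {s} q p r<n s<n eq with ∣ r ⊖ s ∣ in dist
... | zero  = ℤ.+-injective (ℤ.i-j≡0⇒i≡j (+ r) (+ s)
                (trans (ℤ.[+m]-[+n]≡m⊖n r s) (ℤ.∣i∣≡0⇒i≡0 dist)))
... | suc _ = ⊥-elim (>⇒∤ (subst (_< n) dist (ℕ.≤-<-trans (ℤ.∣m⊝n∣≤m⊔n r s) (ℕ.⊔-lub r<n s<n)))
                         (divides ∣ p ℤ.- q ∣ (trans (sym dist) ∣r⊖s∣)))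
  where
  open ≡-Reasoning
  ∣r⊖s∣ : ∣ r ⊖ s ∣ ≡ ∣ p ℤ.- q ∣ ℕ.* n
  ∣r⊖s∣ = begin
    ∣ r ⊖ s ∣                                          ≡⟨ cong ∣_∣ (sym (ℤ.[+m]-[+n]≡m⊖n r s)) ⟩
    ∣ + r ℤ.- + s ∣                                    ≡⟨ cong ∣_∣ (sub-both (+ r) (+ s) (q ℤ.* + n)) ⟩
    ∣ (+ r ℤ.+ q ℤ.* + n) ℤ.- (+ s ℤ.+ q ℤ.* + n) ∣   ≡⟨ cong (λ x → ∣ x ℤ.- (+ s ℤ.+ q ℤ.* + n) ∣) eq ⟩
    ∣ (+ s ℤ.+ p ℤ.* + n) ℤ.- (+ s ℤ.+ q ℤ.* + n) ∣   ≡⟨ cong ∣_∣ (factor (+ s) p q (+ n)) ⟩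
    ∣ (p ℤ.- q) ℤ.* + n ∣                              ≡⟨ ℤ.abs-* (p ℤ.- q) (+ n) ⟩
    ∣ p ℤ.- q ∣ ℕ.* n                                  ∎
    where
    sub-both : ∀ a b c → a ℤ.- b ≡ (a ℤ.+ c) ℤ.- (b ℤ.+ c)
    sub-both = solve-∀
    factor : ∀ a x y m → (a ℤ.+ x ℤ.* m) ℤ.- (a ℤ.+ y ℤ.* m) ≡ (x ℤ.- y) ℤ.* m
    factor = solve-∀

module _ (n : ℕ) .{{_ : NonZero n}} where

  [r+qn]%ℕn≡r : ∀ r q → r < n → (+ r ℤ.+ q ℤ.* + n) %ℕ n ≡ r
  [r+qn]%ℕn≡r r q r<n = sym (residue-unique q (x /ℕ n) r<n (n%ℕd<d x n) (a≡a%ℕn+[a/ℕn]*n x n))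
    where x = + r ℤ.+ q ℤ.* + n

  [r+qn]/ℕn≡q : ∀ r q → r < n → (+ r ℤ.+ q ℤ.* + n) /ℕ n ≡ q
  [r+qn]/ℕn≡q r q r<n = sym (ℤ.*-cancelʳ-≡ q (x /ℕ n) (+ n) (+-cancelˡ (+ r) _ _ (begin
      + r ℤ.+ q ℤ.* + n                ≡⟨ a≡a%ℕn+[a/ℕn]*n x n ⟩
      + (x %ℕ n) ℤ.+ x /ℕ n ℤ.* + n    ≡⟨ cong (λ s → + s ℤ.+ x /ℕ n ℤ.* + n) ([r+qn]%ℕn≡r r q r<n) ⟩
      + r ℤ.+ x /ℕ n ℤ.* + n           ∎)))
    where
    open ≡-Reasoning
    x = + r ℤ.+ q ℤ.* + n

  [x+qn]%ℕn≡x%ℕn : ∀ x q → (x ℤ.+ q ℤ.* + n) %ℕ n ≡ x %ℕ n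
  [x+qn]%ℕn≡x%ℕn x q = begin
    (x ℤ.+ q ℤ.* + n) %ℕ n                                       ≡⟨ cong (λ y → (y ℤ.+ q ℤ.* + n) %ℕ n) (a≡a%ℕn+[a/ℕn]*n x n) ⟩
    (+ (x %ℕ n) ℤ.+ x /ℕ n ℤ.* + n ℤ.+ q ℤ.* + n) %ℕ n          ≡⟨ cong (_%ℕ n) (regroup (+ (x %ℕ n)) (x /ℕ n) q (+ n)) ⟩
    (+ (x %ℕ n) ℤ.+ (x /ℕ n ℤ.+ q) ℤ.* + n) %ℕ n                ≡⟨ [r+qn]%ℕn≡r (x %ℕ n) (x /ℕ n ℤ.+ q) (n%ℕd<d x n) ⟩
    x %ℕ n                                                        ∎
    where
    open ≡-Reasoning
    regroup : ∀ r a b m → r ℤ.+ a ℤ.* m ℤ.+ b ℤ.* m ≡ r ℤ.+ (a ℤ.+ b) ℤ.* m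
    regroup = solve-∀

  [x+k]%ℕn≡[x%ℕn+k]%ℕn : ∀ x k → (x ℤ.+ k) %ℕ n ≡ (+ (x %ℕ n) ℤ.+ k) %ℕ n
  [x+k]%ℕn≡[x%ℕn+k]%ℕn x k = begin
    (x ℤ.+ k) %ℕ n                                      ≡⟨ cong (λ y → (y ℤ.+ k) %ℕ n) (a≡a%ℕn+[a/ℕn]*n x n) ⟩
    (+ (x %ℕ n) ℤ.+ x /ℕ n ℤ.* + n ℤ.+ k) %ℕ n         ≡⟨ cong (_%ℕ n) (swap (+ (x %ℕ n)) (x /ℕ n ℤ.* + n) k) ⟩
    (+ (x %ℕ n) ℤ.+ k ℤ.+ x /ℕ n ℤ.* + n) %ℕ n         ≡⟨ [x+qn]%ℕn≡x%ℕn (+ (x %ℕ n) ℤ.+ k) (x /ℕ n) ⟩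
    (+ (x %ℕ n) ℤ.+ k) %ℕ n                             ∎
    where
    open ≡-Reasoning
    swap : ∀ a b c → a ℤ.+ b ℤ.+ c ≡ a ℤ.+ c ℤ.+ b
    swap = solve-∀

  [c-mj]%ℕn≡[c-m[j%ℕn]]%ℕn : ∀ c m j → (c ℤ.- m ℤ.* j) %ℕ n ≡ (c ℤ.- m ℤ.* + (j %ℕ n)) %ℕ n
  [c-mj]%ℕn≡[c-m[j%ℕn]]%ℕn c m j = begin
    (c ℤ.- m ℤ.* j) %ℕ n                                             ≡⟨ cong (λ i → (c ℤ.- m ℤ.* i) %ℕ n) (a≡a%ℕn+[a/ℕn]*n j n) ⟩
    (c ℤ.- m ℤ.* (+ (j %ℕ n) ℤ.+ j /ℕ n ℤ.* + n)) %ℕ n                ≡⟨ cong (_%ℕ n) (expand c m (+ (j %ℕ n)) (j /ℕ n) (+ n)) ⟩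
    (c ℤ.- m ℤ.* + (j %ℕ n) ℤ.+ (ℤ.- m ℤ.* (j /ℕ n)) ℤ.* + n) %ℕ n   ≡⟨ [x+qn]%ℕn≡x%ℕn (c ℤ.- m ℤ.* + (j %ℕ n)) (ℤ.- m ℤ.* (j /ℕ n)) ⟩
    (c ℤ.- m ℤ.* + (j %ℕ n)) %ℕ n                                    ∎
    where
    open ≡-Reasoning
    expand : ∀ c m r q k → c ℤ.- m ℤ.* (r ℤ.+ q ℤ.* k) ≡ c ℤ.- m ℤ.* r ℤ.+ (ℤ.- m ℤ.* q) ℤ.* k
    expand = solve-∀

x%ℕmn%n≡x%ℕn : ∀ x m n .{{_ : NonZero m}} .{{_ : NonZero n}} →
               ((x %ℕ (m ℕ.* n)) {{ℕ.m*n≢0 m n}}) ℕ.% n ≡ x %ℕ n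
x%ℕmn%n≡x%ℕn x m n = sym (begin
  x %ℕ n                                           ≡⟨ cong (_%ℕ n) (a≡a%ℕn+[a/ℕn]*n x (m ℕ.* n)) ⟩
  (+ r ℤ.+ q ℤ.* + (m ℕ.* n)) %ℕ n                ≡⟨ cong (λ k → (+ r ℤ.+ q ℤ.* k) %ℕ n) (ℤ.pos-* m n) ⟩
  (+ r ℤ.+ q ℤ.* (+ m ℤ.* + n)) %ℕ n              ≡⟨ cong (λ k → (+ r ℤ.+ k) %ℕ n) (sym (ℤ.*-assoc q (+ m) (+ n))) ⟩
  (+ r ℤ.+ q ℤ.* + m ℤ.* + n) %ℕ n                ≡⟨ [x+qn]%ℕn≡x%ℕn n (+ r) (q ℤ.* + m) ⟩
  r ℕ.% n                                          ∎)
  where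
  open ≡-Reasoning
  instance _ = ℕ.m*n≢0 m n
  r = x %ℕ (m ℕ.* n)
  q = x /ℕ (m ℕ.* n)

[a+b]%n≡j%ℕn⇔b≡[j-a]%ℕn : ∀ n .{{_ : NonZero n}} a b j → b < n →
  ((a ℕ.+ b) ℕ.% n ≡ j %ℕ n) ⇔ (b ≡ (j ℤ.- + a) %ℕ n)
[a+b]%n≡j%ℕn⇔b≡[j-a]%ℕn n a b j b<n = mk⇔ to from
  where
  open ≡-Reasoning
  to : (a ℕ.+ b) ℕ.% n ≡ j %ℕ n → b ≡ (j ℤ.- + a) %ℕ n
  to eq = sym (begin
    (j ℤ.- + a) %ℕ n                    ≡⟨ [x+k]%ℕn≡[x%ℕn+k]%ℕn n j (ℤ.- + a) ⟩
    (+ (j %ℕ n) ℤ.- + a) %ℕ n           ≡⟨ cong (λ r → (+ r ℤ.- + a) %ℕ n) eq ⟨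
    (+ ((a ℕ.+ b) ℕ.% n) ℤ.- + a) %ℕ n  ≡⟨ [x+k]%ℕn≡[x%ℕn+k]%ℕn n (+ (a ℕ.+ b)) (ℤ.- + a) ⟨
    (+ (a ℕ.+ b) ℤ.- + a) %ℕ n          ≡⟨ cong (_%ℕ n) (cancel (+ a) (+ b)) ⟩
    b ℕ.% n                             ≡⟨ ℕ.m<n⇒m%n≡m b<n ⟩
    b                                   ∎)
    where
    cancel : ∀ x y → x ℤ.+ y ℤ.- x ≡ y
    cancel = solve-∀
  from : b ≡ (j ℤ.- + a) %ℕ n → (a ℕ.+ b) ℕ.% n ≡ j %ℕ n
  from refl = begin
    (a ℕ.+ (j ℤ.- + a) %ℕ n) ℕ.% n       ≡⟨ cong (ℕ._% n) (ℕ.+-comm a ((j ℤ.- + a) %ℕ n)) ⟩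
    (+ ((j ℤ.- + a) %ℕ n) ℤ.+ + a) %ℕ n  ≡⟨ [x+k]%ℕn≡[x%ℕn+k]%ℕn n (j ℤ.- + a) (+ a) ⟨
    (j ℤ.- + a ℤ.+ + a) %ℕ n             ≡⟨ cong (_%ℕ n) (cancel j (+ a)) ⟩
    j %ℕ n                               ∎
    where
    cancel : ∀ x y → x ℤ.- y ℤ.+ y ≡ x
    cancel = solve-∀

-- Periodic identities, checked on residues

all-below : ∀ n {P : Pred ℕ 0ℓ} (P? : Decidable P) → {True (all? P? (upTo n))} → ∀ {r} → r < n → P r
all-below n P? {check} r<n = All.lookup (toWitness check) (∈-upTo⁺ r<n)

residue-identity : ∀ n .{{_ : NonZero n}} (g c : ℕ → ℤ) k₁ k₂ →
  {True (all? (λ r → c r ℤ.* g ((+ r ℤ.+ k₁) %ℕ n) ℤ.≟ g r ℤ.- g ((+ r ℤ.+ k₂) %ℕ n)) (upTo n))} →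
  ∀ x → c (x %ℕ n) ℤ.* g ((x ℤ.+ k₁) %ℕ n) ≡ g (x %ℕ n) ℤ.- g ((x ℤ.+ k₂) %ℕ n)
residue-identity n g c k₁ k₂ {check} x
  rewrite [x+k]%ℕn≡[x%ℕn+k]%ℕn n x k₁ | [x+k]%ℕn≡[x%ℕn+k]%ℕn n x k₂ =
  all-below n (λ r → c r ℤ.* g ((+ r ℤ.+ k₁) %ℕ n) ℤ.≟ g r ℤ.- g ((+ r ℤ.+ k₂) %ℕ n)) {check} (n%ℕd<d x n)

scaled-difference : ∀ (f : ℤ → ℤ) {K′ y z : ℤ} K c x k₁ k₂ →
  c ℤ.* f (x ℤ.+ k₁) ≡ f x ℤ.- f (x ℤ.+ k₂) → K′ ≡ c ℤ.* K → y ≡ x ℤ.+ k₁ → z ≡ x ℤ.+ k₂ →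
  K′ ℤ.* f y ≡ K ℤ.* f x ℤ.- K ℤ.* f z
scaled-difference f K c x k₁ k₂ eq refl refl refl = begin
  c ℤ.* K ℤ.* f (x ℤ.+ k₁)                      ≡⟨ reassoc c K (f (x ℤ.+ k₁)) ⟩
  K ℤ.* (c ℤ.* f (x ℤ.+ k₁))                    ≡⟨ cong (K ℤ.*_) eq ⟩
  K ℤ.* (f x ℤ.- f (x ℤ.+ k₂))                  ≡⟨ distrib K (f x) (f (x ℤ.+ k₂)) ⟩
  K ℤ.* f x ℤ.- K ℤ.* f (x ℤ.+ k₂)              ∎
  where
  open ≡-Reasoning
  reassoc : ∀ a b y → a ℤ.* b ℤ.* y ≡ b ℤ.* (a ℤ.* y)
  reassoc = solve-∀
  distrib : ∀ a y u → a ℤ.* (y ℤ.- u) ≡ a ℤ.* y ℤ.- a ℤ.* u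
  distrib = solve-∀

-- The closed form and its recursion

-- w c is the number of prime factors of m in class c, for c = 1, …, 5.
Counts : Set
Counts = ℕ → ℕ

total : Counts → ℕ
total w = w 1 ℕ.+ w 2 ℕ.+ w 3 ℕ.+ w 4 ℕ.+ w 5

bump : ℕ → Counts → Counts
bump k w c = if c ≡ᵇ k then suc (w c) else w c

data NonzeroClass : ℕ → Set where
  one   : NonzeroClass 1
  two   : NonzeroClass 2
  three : NonzeroClass 3
  four  : NonzeroClass 4
  five  : NonzeroClass 5

total-bump : ∀ {k} → NonzeroClass k → ∀ w → total (bump k w) ≡ suc (total w)
total-bump one   w = refl
total-bump two   w = cong (λ t → t ℕ.+ w 3 ℕ.+ w 4 ℕ.+ w 5) (ℕ.+-suc (w 1) (w 2))
total-bump three w = cong (λ t → t ℕ.+ w 4 ℕ.+ w 5) (ℕ.+-suc (w 1 ℕ.+ w 2) (w 3))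
total-bump four  w = cong (ℕ._+ w 5) (ℕ.+-suc (w 1 ℕ.+ w 2 ℕ.+ w 3) (w 4))
total-bump five  w = ℕ.+-suc (w 1 ℕ.+ w 2 ℕ.+ w 3 ℕ.+ w 4) (w 5)

α a : Counts → ℤ
α w = + 2 ℤ.* + w 5 ℤ.- + 2 ℤ.* + w 1 ℤ.+ + w 4 ℤ.- + w 2
a w = + w 5 ℤ.- + w 1 ℤ.+ + w 2 ℤ.- + w 4

αphase aphase : Counts → ℤ → ℤ
αphase w j = α w ℤ.- + 2 ℤ.* j
aphase w j = a w ℤ.- + 4 ℤ.* j

signTable : ℕ → ℤ
signTable r = if r ≡ᵇ 0 then + 1 else ℤ.- + 1

sign : ℤ → ℤ
sign j = signTable (j %ℕ 2)

threeIfEven : ℕ → ℤ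
threeIfEven r = if r ≡ᵇ 0 then + 3 else + 1

scale₁ scale₂ scale₃ : Counts → ℤ
scale₁ w = (+ 2) ℤ.^ w 3 ℤ.* (+ 3) ℤ.^ ⌈ w 2 ℕ.+ w 4 /2⌉
scale₂ w = (+ 0) ℤ.^ w 3 ℤ.* (+ 3) ℤ.^ ⌈ total w /2⌉
scale₃ w = (+ 0) ℤ.^ (w 2 ℕ.+ w 4) ℤ.* (+ 2) ℤ.^ total w

-- sixT w j is 6·T(m, j): term₁, term₂, term₃ are six times the three terms of
-- the formula, and term₀ = 0^ω is the correction needed for m̄ = 1.
term₀ term₁ term₂ term₃ sixT : Counts → ℤ → ℤ
term₀ w j = (+ 0) ℤ.^ total w
term₁ w j = scale₁ w ℤ.* v (αphase w j)
term₂ w j = scale₂ w ℤ.* v (aphase w j)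
term₃ w j = scale₃ w ℤ.* sign j
sixT w j = term₀ w j ℤ.+ term₁ w j ℤ.+ term₂ w j ℤ.+ term₃ w j

3^⌈suc-n/2⌉ : ∀ n → (+ 3) ℤ.^ ⌈ suc n /2⌉ ≡ threeIfEven (n ℕ.% 2) ℤ.* (+ 3) ℤ.^ ⌈ n /2⌉
3^⌈suc-n/2⌉ zero          = refl
3^⌈suc-n/2⌉ (suc zero)    = refl
3^⌈suc-n/2⌉ (suc (suc n)) = begin
  + 3 ℤ.* (+ 3) ℤ.^ ⌈ suc n /2⌉                                      ≡⟨ cong (+ 3 ℤ.*_) (3^⌈suc-n/2⌉ n) ⟩
  + 3 ℤ.* (threeIfEven (n ℕ.% 2) ℤ.* (+ 3) ℤ.^ ⌈ n /2⌉)             ≡⟨ swap (+ 3) (threeIfEven (n ℕ.% 2)) _ ⟩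
  threeIfEven (n ℕ.% 2) ℤ.* (+ 3 ℤ.* (+ 3) ℤ.^ ⌈ n /2⌉)             ≡⟨ cong (λ r → threeIfEven r ℤ.* (+ 3 ℤ.* (+ 3) ℤ.^ ⌈ n /2⌉)) n+2%2 ⟨
  threeIfEven (suc (suc n) ℕ.% 2) ℤ.* (+ 3 ℤ.* (+ 3) ℤ.^ ⌈ n /2⌉)   ∎
  where
  open ≡-Reasoning
  swap : ∀ x y z → x ℤ.* (y ℤ.* z) ≡ y ℤ.* (x ℤ.* z)
  swap = solve-∀
  n+2%2 : suc (suc n) ℕ.% 2 ≡ n ℕ.% 2
  n+2%2 = trans (cong (ℕ._% 2) (ℕ.+-comm 2 n)) (ℕ.[m+n]%n≡m%n n 2)

3^⌈suc-n/2⌉-phase : ∀ P n x → x %ℕ 2 ≡ n ℕ.% 2 →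
  P ℤ.* (+ 3) ℤ.^ ⌈ suc n /2⌉ ≡ threeIfEven ((x %ℕ 12) ℕ.% 2) ℤ.* (P ℤ.* (+ 3) ℤ.^ ⌈ n /2⌉)
3^⌈suc-n/2⌉-phase P n x parity = begin
  P ℤ.* (+ 3) ℤ.^ ⌈ suc n /2⌉                                    ≡⟨ cong (P ℤ.*_) (3^⌈suc-n/2⌉ n) ⟩
  P ℤ.* (threeIfEven (n ℕ.% 2) ℤ.* (+ 3) ℤ.^ ⌈ n /2⌉)           ≡⟨ swap P (threeIfEven (n ℕ.% 2)) _ ⟩
  threeIfEven (n ℕ.% 2) ℤ.* (P ℤ.* (+ 3) ℤ.^ ⌈ n /2⌉)           ≡⟨ cong (λ r → threeIfEven r ℤ.* (P ℤ.* (+ 3) ℤ.^ ⌈ n /2⌉)) residue ⟨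
  threeIfEven ((x %ℕ 12) ℕ.% 2) ℤ.* (P ℤ.* (+ 3) ℤ.^ ⌈ n /2⌉)   ∎
  where
  open ≡-Reasoning
  swap : ∀ x y z → x ℤ.* (y ℤ.* z) ≡ y ℤ.* (x ℤ.* z)
  swap = solve-∀
  residue : (x %ℕ 12) ℕ.% 2 ≡ n ℕ.% 2
  residue = trans (x%ℕmn%n≡x%ℕn x 6 2) parity

phase-shift : ∀ m x j k → x ℤ.- m ℤ.* (j ℤ.- k) ≡ (x ℤ.- m ℤ.* j) ℤ.+ m ℤ.* k
phase-shift = solve-∀

α-phase-bump : ∀ e₁ e₂ e₄ e₅ x₁ x₂ x₄ x₅ j →
  + 2 ℤ.* (e₅ ℤ.+ x₅) ℤ.- + 2 ℤ.* (e₁ ℤ.+ x₁) ℤ.+ (e₄ ℤ.+ x₄) ℤ.- (e₂ ℤ.+ x₂) ℤ.- + 2 ℤ.* j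
  ≡ (+ 2 ℤ.* x₅ ℤ.- + 2 ℤ.* x₁ ℤ.+ x₄ ℤ.- x₂ ℤ.- + 2 ℤ.* j) ℤ.+ (+ 2 ℤ.* e₅ ℤ.- + 2 ℤ.* e₁ ℤ.+ e₄ ℤ.- e₂)
α-phase-bump = solve-∀

a-phase-bump : ∀ e₁ e₂ e₄ e₅ x₁ x₂ x₄ x₅ j →
  (e₅ ℤ.+ x₅) ℤ.- (e₁ ℤ.+ x₁) ℤ.+ (e₂ ℤ.+ x₂) ℤ.- (e₄ ℤ.+ x₄) ℤ.- + 4 ℤ.* j
  ≡ (x₅ ℤ.- x₁ ℤ.+ x₂ ℤ.- x₄ ℤ.- + 4 ℤ.* j) ℤ.+ (e₅ ℤ.- e₁ ℤ.+ e₂ ℤ.- e₄)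
a-phase-bump = solve-∀

αphase-parity : ∀ w j → αphase w j %ℕ 2 ≡ (w 2 ℕ.+ w 4) ℕ.% 2
αphase-parity w j =
  trans (cong (_%ℕ 2) (regroup (+ w 1) (+ w 2) (+ w 4) (+ w 5) j))
        ([x+qn]%ℕn≡x%ℕn 2 (+ (w 2 ℕ.+ w 4)) (+ w 5 ℤ.- + w 1 ℤ.- + w 2 ℤ.- j))
  where
  regroup : ∀ x₁ x₂ x₄ x₅ j → + 2 ℤ.* x₅ ℤ.- + 2 ℤ.* x₁ ℤ.+ x₄ ℤ.- x₂ ℤ.- + 2 ℤ.* j
                            ≡ (x₂ ℤ.+ x₄) ℤ.+ (x₅ ℤ.- x₁ ℤ.- x₂ ℤ.- j) ℤ.* + 2
  regroup = solve-∀

aphase-parity : ∀ w j → w 3 ≡ 0 → aphase w j %ℕ 2 ≡ total w ℕ.% 2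
aphase-parity w j w₃≡0 = begin
  aphase w j %ℕ 2                                         ≡⟨ cong (_%ℕ 2) (ℤ.+-identityʳ (aphase w j)) ⟨
  (aphase w j ℤ.- + 0) %ℕ 2                               ≡⟨ cong (λ t → (aphase w j ℤ.- + t) %ℕ 2) w₃≡0 ⟨
  (aphase w j ℤ.- + w 3) %ℕ 2                             ≡⟨ cong (_%ℕ 2) (regroup (+ w 1) (+ w 2) (+ w 3) (+ w 4) (+ w 5) j) ⟩
  (+ total w ℤ.+ (ℤ.- + w 1 ℤ.- + w 3 ℤ.- + w 4 ℤ.- + 2 ℤ.* j) ℤ.* + 2) %ℕ 2
                                                           ≡⟨ [x+qn]%ℕn≡x%ℕn 2 (+ total w) (ℤ.- + w 1 ℤ.- + w 3 ℤ.- + w 4 ℤ.- + 2 ℤ.* j) ⟩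
  total w ℕ.% 2                                           ∎
  where
  open ≡-Reasoning
  regroup : ∀ x₁ x₂ x₃ x₄ x₅ j → x₅ ℤ.- x₁ ℤ.+ x₂ ℤ.- x₄ ℤ.- + 4 ℤ.* j ℤ.- x₃
                               ≡ (x₁ ℤ.+ x₂ ℤ.+ x₃ ℤ.+ x₄ ℤ.+ x₅) ℤ.+ (ℤ.- x₁ ℤ.- x₃ ℤ.- x₄ ℤ.- + 2 ℤ.* j) ℤ.* + 2
  regroup = solve-∀

scale₂-step : ∀ t n x → (t ≡ 0 → x %ℕ 2 ≡ n ℕ.% 2) →
  (+ 0) ℤ.^ t ℤ.* (+ 3) ℤ.^ ⌈ suc n /2⌉ ≡ threeIfEven ((x %ℕ 12) ℕ.% 2) ℤ.* ((+ 0) ℤ.^ t ℤ.* (+ 3) ℤ.^ ⌈ n /2⌉)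
scale₂-step zero    n x parity = 3^⌈suc-n/2⌉-phase (+ 1) n x (parity refl)
scale₂-step (suc t) n x _      = sym (ℤ.*-zeroʳ (threeIfEven ((x %ℕ 12) ℕ.% 2)))

scale₃-doubles : ∀ {k} → NonzeroClass k → ∀ w →
  (+ 0) ℤ.^ (w 2 ℕ.+ w 4) ℤ.* (+ 2) ℤ.^ total (bump k w) ≡ + 2 ℤ.* scale₃ w
scale₃-doubles cls w =
  trans (cong (λ n → (+ 0) ℤ.^ (w 2 ℕ.+ w 4) ℤ.* (+ 2) ℤ.^ n) (total-bump cls w))
        (swap ((+ 0) ℤ.^ (w 2 ℕ.+ w 4)) (+ 2) ((+ 2) ℤ.^ total w))
  where
  swap : ∀ x y z → x ℤ.* (y ℤ.* z) ≡ y ℤ.* (x ℤ.* z)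
  swap = solve-∀

module _ (w : Counts) (j : ℤ) where

  term₀-bump : ∀ {k} → NonzeroClass k → term₀ (bump k w) j ≡ term₀ w j ℤ.- term₀ w (j ℤ.- + k)
  term₀-bump cls = trans (cong ((+ 0) ℤ.^_) (total-bump cls w)) (sym (ℤ.+-inverseʳ ((+ 0) ℤ.^ total w)))

  term₁-bump : ∀ {k} → NonzeroClass k → term₁ (bump k w) j ≡ term₁ w j ℤ.- term₁ w (j ℤ.- + k)
  term₁-bump one   = scaled-difference v (scale₁ w) (+ 1) (αphase w j) -[1+ 1 ] (+ 2)
    (residue-identity 12 vTable (λ _ → + 1) -[1+ 1 ] (+ 2) (αphase w j))
    (sym (ℤ.*-identityˡ (scale₁ w)))
    (α-phase-bump (+ 1) (+ 0) (+ 0) (+ 0) (+ w 1) (+ w 2) (+ w 4) (+ w 5) j) (phase-shift (+ 2) (α w) j (+ 1))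
  term₁-bump two   = scaled-difference v (scale₁ w) (threeIfEven ((αphase w j %ℕ 12) ℕ.% 2)) (αphase w j) -[1+ 0 ] (+ 4)
    (residue-identity 12 vTable (λ r → threeIfEven (r ℕ.% 2)) -[1+ 0 ] (+ 4) (αphase w j))
    (3^⌈suc-n/2⌉-phase ((+ 2) ℤ.^ w 3) (w 2 ℕ.+ w 4) (αphase w j) (αphase-parity w j))
    (α-phase-bump (+ 0) (+ 1) (+ 0) (+ 0) (+ w 1) (+ w 2) (+ w 4) (+ w 5) j) (phase-shift (+ 2) (α w) j (+ 2))
  term₁-bump three = scaled-difference v (scale₁ w) (+ 2) (αphase w j) (+ 0) (+ 6)
    (residue-identity 12 vTable (λ _ → + 2) (+ 0) (+ 6) (αphase w j))
    (ℤ.*-assoc (+ 2) ((+ 2) ℤ.^ w 3) _)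
    (sym (ℤ.+-identityʳ (αphase w j))) (phase-shift (+ 2) (α w) j (+ 3))
  term₁-bump four  = scaled-difference v (scale₁ w) (threeIfEven ((αphase w j %ℕ 12) ℕ.% 2)) (αphase w j) (+ 1) (+ 8)
    (residue-identity 12 vTable (λ r → threeIfEven (r ℕ.% 2)) (+ 1) (+ 8) (αphase w j))
    (trans (cong (λ n → (+ 2) ℤ.^ w 3 ℤ.* (+ 3) ℤ.^ ⌈ n /2⌉) (ℕ.+-suc (w 2) (w 4)))
           (3^⌈suc-n/2⌉-phase ((+ 2) ℤ.^ w 3) (w 2 ℕ.+ w 4) (αphase w j) (αphase-parity w j)))
    (α-phase-bump (+ 0) (+ 0) (+ 1) (+ 0) (+ w 1) (+ w 2) (+ w 4) (+ w 5) j) (phase-shift (+ 2) (α w) j (+ 4))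
  term₁-bump five  = scaled-difference v (scale₁ w) (+ 1) (αphase w j) (+ 2) (+ 10)
    (residue-identity 12 vTable (λ _ → + 1) (+ 2) (+ 10) (αphase w j))
    (sym (ℤ.*-identityˡ (scale₁ w)))
    (α-phase-bump (+ 0) (+ 0) (+ 0) (+ 1) (+ w 1) (+ w 2) (+ w 4) (+ w 5) j) (phase-shift (+ 2) (α w) j (+ 5))

  term₂-bump : ∀ {k} → NonzeroClass k → term₂ (bump k w) j ≡ term₂ w j ℤ.- term₂ w (j ℤ.- + k)
  term₂-bump one   = scaled-difference v (scale₂ w) (threeIfEven ((aphase w j %ℕ 12) ℕ.% 2)) (aphase w j) -[1+ 0 ] (+ 4)
    (residue-identity 12 vTable (λ r → threeIfEven (r ℕ.% 2)) -[1+ 0 ] (+ 4) (aphase w j))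
    (scale₂-step (w 3) (total w) (aphase w j) (aphase-parity w j))
    (a-phase-bump (+ 1) (+ 0) (+ 0) (+ 0) (+ w 1) (+ w 2) (+ w 4) (+ w 5) j) (phase-shift (+ 4) (a w) j (+ 1))
  term₂-bump two   = scaled-difference v (scale₂ w) (threeIfEven ((aphase w j %ℕ 12) ℕ.% 2)) (aphase w j) (+ 1) (+ 8)
    (residue-identity 12 vTable (λ r → threeIfEven (r ℕ.% 2)) (+ 1) (+ 8) (aphase w j))
    (trans (cong (λ n → (+ 0) ℤ.^ w 3 ℤ.* (+ 3) ℤ.^ ⌈ n /2⌉) (total-bump two w))
           (scale₂-step (w 3) (total w) (aphase w j) (aphase-parity w j)))
    (a-phase-bump (+ 0) (+ 1) (+ 0) (+ 0) (+ w 1) (+ w 2) (+ w 4) (+ w 5) j) (phase-shift (+ 4) (a w) j (+ 2))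
  term₂-bump three = scaled-difference v (scale₂ w) (+ 0) (aphase w j) (+ 0) (+ 12)
    (residue-identity 12 vTable (λ _ → + 0) (+ 0) (+ 12) (aphase w j))
    refl
    (sym (ℤ.+-identityʳ (aphase w j))) (phase-shift (+ 4) (a w) j (+ 3))
  term₂-bump four  = scaled-difference v (scale₂ w) (threeIfEven ((aphase w j %ℕ 12) ℕ.% 2)) (aphase w j) -[1+ 0 ] (+ 16)
    (residue-identity 12 vTable (λ r → threeIfEven (r ℕ.% 2)) -[1+ 0 ] (+ 16) (aphase w j))
    (trans (cong (λ n → (+ 0) ℤ.^ w 3 ℤ.* (+ 3) ℤ.^ ⌈ n /2⌉) (total-bump four w))
           (scale₂-step (w 3) (total w) (aphase w j) (aphase-parity w j)))
    (a-phase-bump (+ 0) (+ 0) (+ 1) (+ 0) (+ w 1) (+ w 2) (+ w 4) (+ w 5) j) (phase-shift (+ 4) (a w) j (+ 4))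
  term₂-bump five  = scaled-difference v (scale₂ w) (threeIfEven ((aphase w j %ℕ 12) ℕ.% 2)) (aphase w j) (+ 1) (+ 20)
    (residue-identity 12 vTable (λ r → threeIfEven (r ℕ.% 2)) (+ 1) (+ 20) (aphase w j))
    (trans (cong (λ n → (+ 0) ℤ.^ w 3 ℤ.* (+ 3) ℤ.^ ⌈ n /2⌉) (total-bump five w))
           (scale₂-step (w 3) (total w) (aphase w j) (aphase-parity w j)))
    (a-phase-bump (+ 0) (+ 0) (+ 0) (+ 1) (+ w 1) (+ w 2) (+ w 4) (+ w 5) j) (phase-shift (+ 4) (a w) j (+ 5))

  term₃-bump : ∀ {k} → NonzeroClass k → term₃ (bump k w) j ≡ term₃ w j ℤ.- term₃ w (j ℤ.- + k)
  term₃-bump one   = scaled-difference sign (scale₃ w) (+ 2) j (+ 0) -[1+ 0 ]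
    (residue-identity 2 signTable (λ _ → + 2) (+ 0) -[1+ 0 ] j)
    (scale₃-doubles one w) (sym (ℤ.+-identityʳ j)) refl
  term₃-bump two   = scaled-difference sign (scale₃ w) (+ 0) j (+ 0) -[1+ 1 ]
    (residue-identity 2 signTable (λ _ → + 0) (+ 0) -[1+ 1 ] j)
    refl (sym (ℤ.+-identityʳ j)) refl
  term₃-bump three = scaled-difference sign (scale₃ w) (+ 2) j (+ 0) -[1+ 2 ]
    (residue-identity 2 signTable (λ _ → + 2) (+ 0) -[1+ 2 ] j)
    (scale₃-doubles three w) (sym (ℤ.+-identityʳ j)) refl
  term₃-bump four  = scaled-difference sign (scale₃ w) (+ 0) j (+ 0) -[1+ 3 ]
    (residue-identity 2 signTable (λ _ → + 0) (+ 0) -[1+ 3 ] j)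
    (cong (λ n → (+ 0) ℤ.^ n ℤ.* (+ 2) ℤ.^ total (bump 4 w)) (ℕ.+-suc (w 2) (w 4)))
    (sym (ℤ.+-identityʳ j)) refl
  term₃-bump five  = scaled-difference sign (scale₃ w) (+ 2) j (+ 0) -[1+ 4 ]
    (residue-identity 2 signTable (λ _ → + 2) (+ 0) -[1+ 4 ] j)
    (scale₃-doubles five w) (sym (ℤ.+-identityʳ j)) refl

sixT-bump : ∀ {k} → NonzeroClass k → ∀ w j → sixT (bump k w) j ≡ sixT w j ℤ.- sixT w (j ℤ.- + k)
sixT-bump {k} cls w j = begin
  sixT (bump k w) j
    ≡⟨ cong₂ ℤ._+_ (cong₂ ℤ._+_ (cong₂ ℤ._+_ (term₀-bump w j cls) (term₁-bump w j cls)) (term₂-bump w j cls))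
                   (term₃-bump w j cls) ⟩
  (term₀ w j ℤ.- term₀ w j′) ℤ.+ (term₁ w j ℤ.- term₁ w j′) ℤ.+ (term₂ w j ℤ.- term₂ w j′) ℤ.+ (term₃ w j ℤ.- term₃ w j′)
    ≡⟨ regroup (term₀ w j) (term₀ w j′) (term₁ w j) (term₁ w j′) (term₂ w j) (term₂ w j′) (term₃ w j) (term₃ w j′) ⟩
  sixT w j ℤ.- sixT w j′
    ∎
  where
  open ≡-Reasoning
  j′ = j ℤ.- + k
  regroup : ∀ a a′ b b′ c c′ d d′ →
    (a ℤ.- a′) ℤ.+ (b ℤ.- b′) ℤ.+ (c ℤ.- c′) ℤ.+ (d ℤ.- d′) ≡ (a ℤ.+ b ℤ.+ c ℤ.+ d) ℤ.- (a′ ℤ.+ b′ ℤ.+ c′ ℤ.+ d′)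
  regroup = solve-∀

none : Counts
none _ = 0

sixT-none : ∀ j → sixT none j ≡ (if j %ℕ 6 ≡ᵇ 0 then + 6 else + 0)
sixT-none j = begin
  sixT none j
    ≡⟨⟩
  F (αphase none j %ℕ 12) (aphase none j %ℕ 12) (j %ℕ 2)
    ≡⟨ cong (λ x → F x (aphase none j %ℕ 12) (j %ℕ 2)) ([c-mj]%ℕn≡[c-m[j%ℕn]]%ℕn 12 (α none) (+ 2) j) ⟩
  F (αphase none r′ %ℕ 12) (aphase none j %ℕ 12) (j %ℕ 2)
    ≡⟨ cong (λ y → F (αphase none r′ %ℕ 12) y (j %ℕ 2)) ([c-mj]%ℕn≡[c-m[j%ℕn]]%ℕn 12 (a none) (+ 4) j) ⟩
  F (αphase none r′ %ℕ 12) (aphase none r′ %ℕ 12) (j %ℕ 2)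
    ≡⟨ cong (F (αphase none r′ %ℕ 12) (aphase none r′ %ℕ 12)) (x%ℕmn%n≡x%ℕn j 6 2) ⟨
  sixT none r′
    ≡⟨ all-below 12 (λ r → sixT none (+ r) ℤ.≟ (if r ℕ.% 6 ≡ᵇ 0 then + 6 else + 0)) (n%ℕd<d j 12) ⟩
  (if r ℕ.% 6 ≡ᵇ 0 then + 6 else + 0)
    ≡⟨ cong (λ s → if s ≡ᵇ 0 then + 6 else + 0) (x%ℕmn%n≡x%ℕn j 2 6) ⟩
  (if j %ℕ 6 ≡ᵇ 0 then + 6 else + 0)
    ∎
  where
  open ≡-Reasoning
  r = j %ℕ 12
  r′ = + r
  F : ℕ → ℕ → ℕ → ℤ
  F x y z = + 1 ℤ.+ scale₁ none ℤ.* vTable x ℤ.+ scale₂ none ℤ.* vTable y ℤ.+ scale₃ none ℤ.* signTable z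

sixT-nonempty : ∀ w j → total w ≢ 0 → sixT w j ≡ term₁ w j ℤ.+ term₂ w j ℤ.+ term₃ w j
sixT-nonempty w j W≢0 =
  cong (λ x → x ℤ.+ term₂ w j ℤ.+ term₃ w j)
       (trans (cong (ℤ._+ term₁ w j) (0^n≡0 (total w) W≢0)) (ℤ.+-identityˡ (term₁ w j)))
  where
  0^n≡0 : ∀ n → n ≢ 0 → (+ 0) ℤ.^ n ≡ + 0
  0^n≡0 zero    n≢0 = ⊥-elim (n≢0 refl)
  0^n≡0 (suc n) _   = refl

-- Möbius sums over divisors

sumℤ-++ : ∀ xs ys → sumℤ (xs ++ ys) ≡ sumℤ xs ℤ.+ sumℤ ys
sumℤ-++ []       ys = sym (ℤ.+-identityˡ (sumℤ ys))
sumℤ-++ (x ∷ xs) ys = trans (cong (λ s → x ℤ.+ s) (sumℤ-++ xs ys)) (sym (ℤ.+-assoc x (sumℤ xs) (sumℤ ys)))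

sumℤ-↭ : ∀ {xs ys} → xs ↭ ys → sumℤ xs ≡ sumℤ ys
sumℤ-↭ p = foldr-commMonoid ℤ-+-0.setoid ℤ-+-0.isCommutativeMonoid (↭⇒↭ₛ p)
  where module ℤ-+-0 = CommutativeMonoid ℤ.+-0-commutativeMonoid

sumℤ-neg : ∀ xs → sumℤ (map ℤ.-_ xs) ≡ ℤ.- sumℤ xs
sumℤ-neg []       = refl
sumℤ-neg (x ∷ xs) = trans (cong (λ s → ℤ.- x ℤ.+ s) (sumℤ-neg xs)) (sym (ℤ.neg-distrib-+ x (sumℤ xs)))

sumℤ-filter : ∀ {P : ℕ → Set} (P? : Decidable P) (f : ℕ → ℤ) xs →
  sumℤ (map f (filter P? xs)) ≡ sumℤ (map (λ x → if does (P? x) then f x else + 0) xs)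
sumℤ-filter P? f []       = refl
sumℤ-filter P? f (x ∷ xs) with does (P? x)
... | true  = cong (λ s → f x ℤ.+ s) (sumℤ-filter P? f xs)
... | false = trans (sumℤ-filter P? f xs) (sym (ℤ.+-identityˡ _))

∈-divisors⁻ : ∀ {d n} → d ∈ divisors n → d ∣ n
∈-divisors⁻ {n = n} d∈ = proj₂ (∈-filter⁻ (_∣? n) {xs = upTo (suc n)} d∈)

∈-divisors⁺ : ∀ {d n} .{{_ : NonZero n}} → d ∣ n → d ∈ divisors n
∈-divisors⁺ {n = n} d∣n = ∈-filter⁺ (_∣? n) (∈-upTo⁺ (s≤s (∣⇒≤ d∣n))) d∣n

divisors-unique : ∀ n → Unique (divisors n)
divisors-unique n = Unique.filter⁺ (_∣? n) (Unique.upTo⁺ (suc n))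

∈-primeDivisors⁻ : ∀ {q n} → q ∈ primeDivisors n → Prime q × q ∣ n
∈-primeDivisors⁻ {n = n} q∈ = proj₂ (∈-filter⁻ (λ p → prime? p ×-dec (p ∣? n)) {xs = upTo (suc n)} q∈)

∈-primeDivisors⁺ : ∀ {q n} .{{_ : NonZero n}} → Prime q → q ∣ n → q ∈ primeDivisors n
∈-primeDivisors⁺ {n = n} q-prime q∣n =
  ∈-filter⁺ (λ p → prime? p ×-dec (p ∣? n)) (∈-upTo⁺ (s≤s (∣⇒≤ q∣n))) (q-prime , q∣n)

primeDivisors-unique : ∀ n → Unique (primeDivisors n)
primeDivisors-unique n = Unique.filter⁺ (λ p → prime? p ×-dec (p ∣? n)) (Unique.upTo⁺ (suc n))

prime∤⇒coprime : ∀ {p n} → Prime p → ¬ p ∣ n → Coprime p n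
prime∤⇒coprime p-prime p∤n (i∣p , i∣n) with prime⇒irreducible p-prime i∣p
... | inj₁ i≡1 = i≡1
... | inj₂ refl = ⊥-elim (p∤n i∣n)

module _ {p N} (p-prime : Prime p) .{{_ : NonZero N}} (p∤N : ¬ p ∣ N) where

  private instance
    p≢0  = prime⇒nonZero p-prime
    pN≢0 = ℕ.m*n≢0 p N

  divisors-* : divisors (p ℕ.* N) ↭ divisors N ++ map (p ℕ.*_) (divisors N)
  divisors-* = ∼bag⇒↭ (unique∧set⇒bag (divisors-unique (p ℕ.* N)) disjoint-union (mk⇔ to from))
    where
    to : ∀ {d} → d ∈ divisors (p ℕ.* N) → d ∈ divisors N ++ map (p ℕ.*_) (divisors N)
    to {d} d∈ with p ∣? d
    ... | yes (divides e refl) = ∈-++⁺ʳ (divisors N)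
            (subst (_∈ map (p ℕ.*_) (divisors N)) (ℕ.*-comm p e)
              (∈-map⁺ (p ℕ.*_) (∈-divisors⁺ (*-cancelˡ-∣ p (subst (_∣ p ℕ.* N) (ℕ.*-comm e p) (∈-divisors⁻ d∈))))))
    ... | no p∤d = ∈-++⁺ˡ (∈-divisors⁺ (Coprime.coprime-divisor (Coprime.sym (prime∤⇒coprime p-prime p∤d)) (∈-divisors⁻ d∈)))
    from : ∀ {d} → d ∈ divisors N ++ map (p ℕ.*_) (divisors N) → d ∈ divisors (p ℕ.* N)
    from {d} d∈ with ∈-++⁻ (divisors N) d∈
    ... | inj₁ d∈N = ∈-divisors⁺ (∣n⇒∣m*n p (∈-divisors⁻ d∈N))
    ... | inj₂ d∈pN with ∈-map⁻ (p ℕ.*_) d∈pN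
    ... | e , e∈N , refl = ∈-divisors⁺ (*-monoʳ-∣ p (∈-divisors⁻ e∈N))
    disjoint-union : Unique (divisors N ++ map (p ℕ.*_) (divisors N))
    disjoint-union = Unique.++⁺ (divisors-unique N) (Unique.map⁺ (ℕ.*-cancelˡ-≡ _ _ p) (divisors-unique N)) disjoint
      where
      disjoint : ∀ {d} → d ∈ divisors N × d ∈ map (p ℕ.*_) (divisors N) → ⊥
      disjoint (d∈N , d∈pN) with ∈-map⁻ (p ℕ.*_) d∈pN
      ... | e , _ , refl = p∤N (∣-trans (m∣m*n e) (∈-divisors⁻ d∈N))

  primeDivisors-* : primeDivisors (p ℕ.* N) ↭ p ∷ primeDivisors N
  primeDivisors-* = ∼bag⇒↭ (unique∧set⇒bag (primeDivisors-unique (p ℕ.* N)) p∷unique (mk⇔ to from))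
    where
    to : ∀ {q} → q ∈ primeDivisors (p ℕ.* N) → q ∈ p ∷ primeDivisors N
    to q∈ with ∈-primeDivisors⁻ q∈
    ... | q-prime , q∣pN with euclidsLemma p N q-prime q∣pN
    ... | inj₂ q∣N = there (∈-primeDivisors⁺ q-prime q∣N)
    ... | inj₁ q∣p with prime⇒irreducible p-prime q∣p
    ... | inj₁ refl = ⊥-elim (¬prime[1] q-prime)
    ... | inj₂ refl = here refl
    from : ∀ {q} → q ∈ p ∷ primeDivisors N → q ∈ primeDivisors (p ℕ.* N)
    from (here refl) = ∈-primeDivisors⁺ p-prime (m∣m*n N)
    from (there q∈N) with ∈-primeDivisors⁻ q∈N
    ... | q-prime , q∣N = ∈-primeDivisors⁺ q-prime (∣n⇒∣m*n p q∣N)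
    p∷unique : Unique (p ∷ primeDivisors N)
    p∷unique = All.tabulate (λ q∈N p≡q → p∤N (subst (_∣ N) (sym p≡q) (proj₂ (∈-primeDivisors⁻ q∈N)))) ∷ primeDivisors-unique N

HasSquareFactor : ℕ → Set
HasSquareFactor d = ∃[ q ] Prime q × q ℕ.* q ∣ d

-- μ d unfolds to: if squareTest d then 0 else (−1)^(number of prime divisors of d).
squareTest : ℕ → Bool
squareTest d = any (λ p → does (prime? p) ∧ does (p ℕ.* p ∣? d)) (upTo (suc d))

T-squareTest : ∀ d .{{_ : NonZero d}} → Bool.T (squareTest d) ⇔ HasSquareFactor d
T-squareTest d = mk⇔ to from
  where
  test : ℕ → Bool
  test p = does (prime? p) ∧ does (p ℕ.* p ∣? d)
  to : Bool.T (squareTest d) → HasSquareFactor d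
  to t with satisfied (any⁻ test (upTo (suc d)) t)
  ... | q , tq with prime? q | q ℕ.* q ∣? d
  ...   | yes q-prime | yes qq∣d = q , q-prime , qq∣d
  ...   | no _        | _        = ⊥-elim tq
  ...   | yes _       | no _     = ⊥-elim tq
  from : HasSquareFactor d → Bool.T (squareTest d)
  from (q , q-prime , qq∣d) = any⁺ test (lose q∈ holds)
    where
    instance _ = prime⇒nonZero q-prime
    q∈ : q ∈ upTo (suc d)
    q∈ = ∈-upTo⁺ (s≤s (ℕ.≤-trans (ℕ.m≤m*n q q) (∣⇒≤ qq∣d)))
    holds : Bool.T (test q)
    holds with prime? q | q ℕ.* q ∣? d
    ... | yes _     | yes _    = _
    ... | no ¬prime | _        = ¬prime q-prime
    ... | yes _     | no ¬qq∣d = ¬qq∣d qq∣d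

hasSquareFactor-* : ∀ {p d} → Prime p → ¬ p ∣ d → HasSquareFactor (p ℕ.* d) ⇔ HasSquareFactor d
hasSquareFactor-* {p} {d} p-prime p∤d = mk⇔ to from
  where
  to : HasSquareFactor (p ℕ.* d) → HasSquareFactor d
  to (q , q-prime , qq∣pd) with q ℕ.≟ p
  ... | yes refl = ⊥-elim (p∤d (*-cancelˡ-∣ p {{prime⇒nonZero p-prime}} qq∣pd))
  ... | no q≢p   = q , q-prime , Coprime.coprime-divisor (Coprime.sym (prime∤⇒coprime p-prime p∤qq)) qq∣pd
    where
    p∤q : ¬ p ∣ q
    p∤q p∣q with prime⇒irreducible q-prime p∣q
    ... | inj₁ refl = ¬prime[1] p-prime
    ... | inj₂ refl = q≢p refl
    p∤qq : ¬ p ∣ q ℕ.* q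
    p∤qq p∣qq = [ p∤q , p∤q ] (euclidsLemma q q p-prime p∣qq)
  from : HasSquareFactor d → HasSquareFactor (p ℕ.* d)
  from (q , q-prime , qq∣d) = q , q-prime , ∣n⇒∣m*n p qq∣d

squareTest-* : ∀ {p d} → Prime p → .{{_ : NonZero d}} → ¬ p ∣ d → squareTest (p ℕ.* d) ≡ squareTest d
squareTest-* {p} {d} p-prime p∤d =
  does-⇔ (⇔.trans (T-squareTest (p ℕ.* d)) (⇔.trans (hasSquareFactor-* p-prime p∤d) (⇔.sym (T-squareTest d))))
         (T? _) (T? _)
  where instance _ = ℕ.m*n≢0 p d {{prime⇒nonZero p-prime}}

μ-* : ∀ {p d} → Prime p → .{{_ : NonZero d}} → ¬ p ∣ d → μ (p ℕ.* d) ≡ ℤ.- μ d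
μ-* {p} {d} p-prime p∤d
  rewrite squareTest-* p-prime p∤d | ↭.↭-length (primeDivisors-* p-prime p∤d) with squareTest d
... | true  = refl
... | false = ℤ.-1*i≡-i _

-- ℓ n unfolds to ℓᵣ (n % 31).
ℓᵣ : ℕ → ℕ
ℓᵣ r = go (upTo 6)
  where
  go : List ℕ → ℕ
  go []       = 0
  go (j ∷ js) = if any (λ k → ((2 ℕ.^ k ℕ.* 3 ℕ.^ j) ℕ.% 31) ≡ᵇ r) (upTo 5) then j else go js

ℓ<6 : ∀ n → ℓ n < 6
ℓ<6 n = all-below 31 (λ r → ℓᵣ r ℕ.<? 6) (ℕ.m%n<n n 31)

ℓ-* : ∀ a b → ¬ 31 ∣ a → ¬ 31 ∣ b → ℓ (a ℕ.* b) ≡ (ℓ a ℕ.+ ℓ b) ℕ.% 6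
ℓ-* a b 31∤a 31∤b = begin
  ℓᵣ ((a ℕ.* b) ℕ.% 31)                          ≡⟨ cong ℓᵣ (ℕ.%-distribˡ-* a b 31) ⟩
  ℓᵣ ((a ℕ.% 31 ℕ.* (b ℕ.% 31)) ℕ.% 31)          ≡⟨ residues (ℕ.m%n<n a 31) (λ a%31≡0 → 31∤a (m%n≡0⇒n∣m a 31 a%31≡0))
                                                                         (λ b%31≡0 → 31∤b (m%n≡0⇒n∣m b 31 b%31≡0)) ⟩
  (ℓᵣ (a ℕ.% 31) ℕ.+ ℓᵣ (b ℕ.% 31)) ℕ.% 6        ∎
  where
  open ≡-Reasoning
  Multiplicative : ℕ → ℕ → Set
  Multiplicative x y = x ≢ 0 → y ≢ 0 → ℓᵣ ((x ℕ.* y) ℕ.% 31) ≡ (ℓᵣ x ℕ.+ ℓᵣ y) ℕ.% 6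
  residues : a ℕ.% 31 < 31 → Multiplicative (a ℕ.% 31) (b ℕ.% 31)
  residues a%31<31 = All.lookup
    (all-below 31 (λ x → all? (λ y → ¬? (x ℕ.≟ 0) →-dec ¬? (y ℕ.≟ 0) →-dec ℓᵣ ((x ℕ.* y) ℕ.% 31) ℕ.≟ (ℓᵣ x ℕ.+ ℓᵣ y) ℕ.% 6) (upTo 31)) a%31<31)
    (∈-upTo⁺ (ℕ.m%n<n b 31))

classSum : ℕ → ℤ → ℤ
classSum N j = sumℤ (map μ (filter (λ d → ℓ d ℕ.≟ (j %ℕ 6)) (divisors N)))

inClass : ℤ → ℕ → ℤ
inClass j d = if does (ℓ d ℕ.≟ (j %ℕ 6)) then μ d else + 0

divisor-nonZero : ∀ {d N} .{{_ : NonZero N}} → d ∣ N → NonZero d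
divisor-nonZero {zero}  {N} 0∣N = ⊥-elim (ℕ.≢-nonZero⁻¹ N (0∣⇒≡0 0∣N))
divisor-nonZero {suc _}     _   = _

if-neg : ∀ b x → (if b then ℤ.- x else + 0) ≡ ℤ.- (if b then x else + 0)
if-neg true  x = refl
if-neg false x = refl

inClass-* : ∀ {p d} j → Prime p → .{{_ : NonZero d}} → ¬ p ∣ d → ¬ 31 ∣ p → ¬ 31 ∣ d →
  inClass j (p ℕ.* d) ≡ ℤ.- inClass (j ℤ.- + ℓ p) d
inClass-* {p} {d} j p-prime p∤d 31∤p 31∤d = begin
  (if does (ℓ (p ℕ.* d) ℕ.≟ (j %ℕ 6)) then μ (p ℕ.* d) else + 0)  ≡⟨ cong₂ (λ b x → if b then x else + 0) same-class (μ-* p-prime p∤d) ⟩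
  (if does (ℓ d ℕ.≟ (j′ %ℕ 6)) then ℤ.- μ d else + 0)             ≡⟨ if-neg (does (ℓ d ℕ.≟ (j′ %ℕ 6))) (μ d) ⟩
  ℤ.- inClass j′ d                                                 ∎
  where
  open ≡-Reasoning
  j′ = j ℤ.- + ℓ p
  ℓ[pd] : ℓ (p ℕ.* d) ≡ (ℓ p ℕ.+ ℓ d) ℕ.% 6
  ℓ[pd] = ℓ-* p d 31∤p 31∤d
  same-class : does (ℓ (p ℕ.* d) ℕ.≟ (j %ℕ 6)) ≡ does (ℓ d ℕ.≟ (j′ %ℕ 6))
  same-class = does-⇔ (⇔.trans (mk⇔ (trans (sym ℓ[pd])) (trans ℓ[pd])) ([a+b]%n≡j%ℕn⇔b≡[j-a]%ℕn 6 (ℓ p) (ℓ d) j (ℓ<6 d)))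
                      (ℓ (p ℕ.* d) ℕ.≟ (j %ℕ 6)) (ℓ d ℕ.≟ (j′ %ℕ 6))

classSum-* : ∀ {p N} j → Prime p → .{{_ : NonZero N}} → ¬ p ∣ N → ¬ 31 ∣ p → ¬ 31 ∣ N →
  classSum (p ℕ.* N) j ≡ classSum N j ℤ.- classSum N (j ℤ.- + ℓ p)
classSum-* {p} {N} j p-prime p∤N 31∤p 31∤N = begin
  classSum (p ℕ.* N) j
    ≡⟨ sumℤ-filter (λ d → ℓ d ℕ.≟ (j %ℕ 6)) μ (divisors (p ℕ.* N)) ⟩
  sumℤ (map (inClass j) (divisors (p ℕ.* N)))
    ≡⟨ sumℤ-↭ (↭.map⁺ (inClass j) (divisors-* p-prime p∤N)) ⟩
  sumℤ (map (inClass j) (D ++ map (p ℕ.*_) D))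
    ≡⟨ cong sumℤ (map-++ (inClass j) D (map (p ℕ.*_) D)) ⟩
  sumℤ (map (inClass j) D ++ map (inClass j) (map (p ℕ.*_) D))
    ≡⟨ sumℤ-++ (map (inClass j) D) (map (inClass j) (map (p ℕ.*_) D)) ⟩
  sumℤ (map (inClass j) D) ℤ.+ sumℤ (map (inClass j) (map (p ℕ.*_) D))
    ≡⟨ cong (λ s → sumℤ (map (inClass j) D) ℤ.+ sumℤ s) multiples ⟩
  sumℤ (map (inClass j) D) ℤ.+ sumℤ (map ℤ.-_ (map (inClass j′) D))
    ≡⟨ cong (λ s → sumℤ (map (inClass j) D) ℤ.+ s) (sumℤ-neg (map (inClass j′) D)) ⟩
  sumℤ (map (inClass j) D) ℤ.- sumℤ (map (inClass j′) D)
    ≡⟨ cong₂ ℤ._-_ (sumℤ-filter (λ d → ℓ d ℕ.≟ (j %ℕ 6)) μ D) (sumℤ-filter (λ d → ℓ d ℕ.≟ (j′ %ℕ 6)) μ D) ⟨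
  classSum N j ℤ.- classSum N j′
    ∎
  where
  open ≡-Reasoning
  D  = divisors N
  j′ = j ℤ.- + ℓ p
  multiples : map (inClass j) (map (p ℕ.*_) D) ≡ map ℤ.-_ (map (inClass j′) D)
  multiples = begin
    map (inClass j) (map (p ℕ.*_) D)      ≡⟨ map-∘ D ⟨
    map (λ d → inClass j (p ℕ.* d)) D      ≡⟨ map-cong-local (All.tabulate λ {d} d∈D →
                                                let d∣N = ∈-divisors⁻ d∈D; instance _ = divisor-nonZero d∣N in
                                                inClass-* j p-prime (λ p∣d → p∤N (∣-trans p∣d d∣N)) 31∤p (λ 31∣d → 31∤N (∣-trans 31∣d d∣N))) ⟩
    map (λ d → ℤ.- inClass j′ d) D        ≡⟨ map-∘ D ⟩
    map ℤ.-_ (map (inClass j′) D)         ∎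

-- Induction over the prime factors

Good : ℕ → Set
Good p = Prime p × ¬ 2 ∣ p × p ≢ 31 × ℓ p ≢ 0

counts : List ℕ → Counts
counts ps c = length (filter (InP? c) ps)

counts-∷ : ∀ {p} ps → Good p → ∀ c → counts (p ∷ ps) c ≡ bump (ℓ p) (counts ps) c
counts-∷ {p} ps (p-prime , p-odd , p≢31 , _) c
  rewrite does-⇔ (mk⇔ (λ (_ , _ , _ , ℓp≡c) → sym ℓp≡c) (λ { refl → p-prime , p-odd , p≢31 , refl }))
                 (InP? c p) (c ℕ.≟ ℓ p)
  with c ≡ᵇ ℓ p
... | true  = refl
... | false = refl

nonzeroClass : ∀ {k} → k ≢ 0 → k < 6 → NonzeroClass k
nonzeroClass {0} k≢0 _ = ⊥-elim (k≢0 refl)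
nonzeroClass {1} _ _ = one
nonzeroClass {2} _ _ = two
nonzeroClass {3} _ _ = three
nonzeroClass {4} _ _ = four
nonzeroClass {5} _ _ = five
nonzeroClass {suc (suc (suc (suc (suc (suc _)))))} _ (s≤s (s≤s (s≤s (s≤s (s≤s (s≤s ()))))))

sixT-cong : ∀ {w w′} → (∀ c → w c ≡ w′ c) → ∀ j → sixT w j ≡ sixT w′ j
sixT-cong eq j rewrite eq 1 | eq 2 | eq 3 | eq 4 | eq 5 = refl

six-classSum-1 : ∀ j → + 6 ℤ.* classSum 1 j ≡ (if j %ℕ 6 ≡ᵇ 0 then + 6 else + 0)
six-classSum-1 j = by-residue (j %ℕ 6)
  where
  by-residue : ∀ r → + 6 ℤ.* sumℤ (map μ (filter (λ d → ℓ d ℕ.≟ r) (divisors 1))) ≡ (if r ≡ᵇ 0 then + 6 else + 0)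
  by-residue zero    = refl
  by-residue (suc _) = refl

prime[31] : Prime 31
prime[31] = toWitness {a? = prime? 31} _

six-classSum : ∀ ps → Unique ps → All Good ps → ∀ j → + 6 ℤ.* classSum (product ps) j ≡ sixT (counts ps) j
six-classSum []       _                    _                    j = trans (six-classSum-1 j) (sym (sixT-none j))
six-classSum (p ∷ ps) (p∉ps ∷ ps-unique) (p-good@(p-prime , _ , p≢31 , ℓp≢0) ∷ ps-good) j = begin
  + 6 ℤ.* classSum (p ℕ.* N) j                      ≡⟨ cong (+ 6 ℤ.*_) (classSum-* j p-prime p∤N 31∤p 31∤N) ⟩
  + 6 ℤ.* (classSum N j ℤ.- classSum N j′)          ≡⟨ distrib (classSum N j) (classSum N j′) ⟩
  + 6 ℤ.* classSum N j ℤ.- + 6 ℤ.* classSum N j′    ≡⟨ cong₂ ℤ._-_ (six-classSum ps ps-unique ps-good j) (six-classSum ps ps-unique ps-good j′) ⟩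
  sixT (counts ps) j ℤ.- sixT (counts ps) j′        ≡⟨ sixT-bump (nonzeroClass ℓp≢0 (ℓ<6 p)) (counts ps) j ⟨
  sixT (bump (ℓ p) (counts ps)) j                   ≡⟨ sixT-cong (counts-∷ ps p-good) j ⟨
  sixT (counts (p ∷ ps)) j                          ∎
  where
  open ≡-Reasoning
  N = product ps
  j′ = j ℤ.- + ℓ p
  ps-prime : All Prime ps
  ps-prime = All.map proj₁ ps-good
  instance _ = productOfPrimes≢0 ps-prime
  p∤N : ¬ p ∣ N
  p∤N p∣N = All.lookup p∉ps (factorisationHasAllPrimeFactors p-prime p∣N ps-prime) refl
  31∤p : ¬ 31 ∣ p
  31∤p 31∣p with prime⇒irreducible p-prime 31∣p
  ... | inj₁ ()
  ... | inj₂ 31≡p = p≢31 (sym 31≡p)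
  31∤N : ¬ 31 ∣ N
  31∤N 31∣N with All.lookup ps-good (factorisationHasAllPrimeFactors prime[31] 31∣N ps-prime)
  ... | _ , _ , 31≢31 , _ = 31≢31 refl
  distrib : ∀ a b → + 6 ℤ.* (a ℤ.- b) ≡ + 6 ℤ.* a ℤ.- + 6 ℤ.* b
  distrib = solve-∀

total-counts : ∀ ps → All Good ps → total (counts ps) ≡ length ps
total-counts []       _                    = refl
total-counts (p ∷ ps) (p-good@(_ , _ , _ , ℓp≢0) ∷ ps-good) = begin
  total (counts (p ∷ ps))           ≡⟨ total-cong (counts-∷ ps p-good) ⟩
  total (bump (ℓ p) (counts ps))    ≡⟨ total-bump (nonzeroClass ℓp≢0 (ℓ<6 p)) (counts ps) ⟩
  suc (total (counts ps))           ≡⟨ cong suc (total-counts ps ps-good) ⟩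
  suc (length ps)                   ∎
  where
  open ≡-Reasoning
  total-cong : ∀ {w w′} → (∀ c → w c ≡ w′ c) → total w ≡ total w′
  total-cong eq rewrite eq 1 | eq 2 | eq 3 | eq 4 | eq 5 = refl

prime-factor : ∀ m .{{_ : NonZero m}} → m ≢ 1 → ∃[ q ] Prime q × q ∣ m
prime-factor m m≢1 with factorise m
... | record { factors = [] ; isFactorisation = m≡1 } = ⊥-elim (m≢1 m≡1)
... | record { factors = q ∷ qs ; isFactorisation = m≡qqs ; factorsPrime = q-prime ∷ _ } =
  q , q-prime , subst (q ∣_) (sym m≡qqs) (m∣m*n (product qs))

primeDivisors-good : ∀ m .{{_ : NonZero m}} → ¬ 2 ∣ m → ¬ 31 ∣ m → (∀ p → p ∣ m → ¬ InP 0 p) →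
  All Good (primeDivisors m)
primeDivisors-good m 2∤m 31∤m no-P₀ = All.tabulate good
  where
  good : ∀ {q} → q ∈ primeDivisors m → Good q
  good {q} q∈ with ∈-primeDivisors⁻ q∈
  ... | q-prime , q∣m = q-prime , q-odd , q≢31 , λ ℓq≡0 → no-P₀ q q∣m (q-prime , q-odd , q≢31 , ℓq≡0)
    where
    q-odd : ¬ 2 ∣ q
    q-odd 2∣q = 2∤m (∣-trans 2∣q q∣m)
    q≢31 : q ≢ 31
    q≢31 refl = 31∤m q∣m

∈⇒length≢0 : ∀ {x : ℕ} {xs} → x ∈ xs → length xs ≢ 0
∈⇒length≢0 (here _)  ()
∈⇒length≢0 (there _) ()

-- The rational right-hand side

toℚᵘ-/ : ∀ z d → ℚ.toℚᵘ (z ℚ./ suc d) ℚᵘ.≃ mkℚᵘ z d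
toℚᵘ-/ z d = ℚ.toℚᵘ-fromℚᵘ (mkℚᵘ z d)

toℚ-+ : ∀ a b → toℚ (a ℤ.+ b) ≡ toℚ a ℚ.+ toℚ b
toℚ-+ a b = ℚ.toℚᵘ-injective (begin
  ℚ.toℚᵘ (toℚ (a ℤ.+ b))                   ≈⟨ toℚᵘ-/ (a ℤ.+ b) 0 ⟩
  mkℚᵘ (a ℤ.+ b) 0                          ≈⟨ *≡* (cross a b) ⟩
  mkℚᵘ a 0 ℚᵘ.+ mkℚᵘ b 0                    ≈⟨ ℚᵘ.+-cong (toℚᵘ-/ a 0) (toℚᵘ-/ b 0) ⟨
  ℚ.toℚᵘ (toℚ a) ℚᵘ.+ ℚ.toℚᵘ (toℚ b)        ≈⟨ ℚ.toℚᵘ-homo-+ (toℚ a) (toℚ b) ⟨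
  ℚ.toℚᵘ (toℚ a ℚ.+ toℚ b)                  ∎)
  where
  open ℚᵘ.≃-Reasoning
  cross : ∀ a b → (a ℤ.+ b) ℤ.* + 1 ≡ (a ℤ.* + 1 ℤ.+ b ℤ.* + 1) ℤ.* + 1
  cross = solve-∀

toℚ-* : ∀ a b → toℚ (a ℤ.* b) ≡ toℚ a ℚ.* toℚ b
toℚ-* a b = ℚ.toℚᵘ-injective (begin
  ℚ.toℚᵘ (toℚ (a ℤ.* b))                   ≈⟨ toℚᵘ-/ (a ℤ.* b) 0 ⟩
  mkℚᵘ (a ℤ.* b) 0                          ≈⟨ *≡* refl ⟩
  mkℚᵘ a 0 ℚᵘ.* mkℚᵘ b 0                    ≈⟨ ℚᵘ.*-cong (toℚᵘ-/ a 0) (toℚᵘ-/ b 0) ⟨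
  ℚ.toℚᵘ (toℚ a) ℚᵘ.* ℚ.toℚᵘ (toℚ b)        ≈⟨ ℚ.toℚᵘ-homo-* (toℚ a) (toℚ b) ⟨
  ℚ.toℚᵘ (toℚ a ℚ.* toℚ b)                  ∎)
  where open ℚᵘ.≃-Reasoning

toℚ-^ : ∀ b n → toℚ b ^ℚ n ≡ toℚ (b ℤ.^ n)
toℚ-^ b zero    = refl
toℚ-^ b (suc n) = trans (cong (toℚ b ℚ.*_) (toℚ-^ b n)) (sym (toℚ-* b (b ℤ.^ n)))

pow-pred : ∀ b .{{_ : NonZero b}} n → toℚ (+ b) ℚ.* powℤ b (+ suc n ℤ.- + 1) ≡ toℚ ((+ b) ℤ.^ suc n)
pow-pred b n = trans (cong (toℚ (+ b) ℚ.*_) (toℚ-^ (+ b) n)) (sym (toℚ-* (+ b) ((+ b) ℤ.^ n)))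

2*powℤ[2,n-1] : ∀ n → toℚ (+ 2) ℚ.* powℤ 2 (+ n ℤ.- + 1) ≡ toℚ ((+ 2) ℤ.^ n)
2*powℤ[2,n-1] zero    = refl
2*powℤ[2,n-1] (suc n) = pow-pred 2 n

data Halves : ℕ → Set where
  even : ∀ h → Halves (h ℕ.+ h)
  odd  : ∀ h → Halves (suc (h ℕ.+ h))

halves : ∀ n → Halves n
halves zero = even 0
halves (suc n) with halves n
... | even h = odd h
... | odd  h = subst Halves (cong suc (ℕ.+-suc h h)) (even (suc h))

⌊suc[h+h]/2⌋≡h : ∀ h → ⌊ suc (h ℕ.+ h) /2⌋ ≡ h
⌊suc[h+h]/2⌋≡h zero    = refl
⌊suc[h+h]/2⌋≡h (suc h) = cong suc (trans (cong ⌊_/2⌋ (ℕ.+-suc h h)) (⌊suc[h+h]/2⌋≡h h))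

odd-coprime-2 : ∀ h → Coprime (suc (h ℕ.+ h)) 2
odd-coprime-2 zero    = Coprime.1-coprimeTo 2
odd-coprime-2 (suc h) = subst (λ n → Coprime (suc n) 2) (cong suc (sym (ℕ.+-suc h h))) (Coprime.coprime-+ (odd-coprime-2 h))

half-minus-one : ∀ z → ℚ.toℚᵘ (z ℚ./ 2 ℚ.- 1ℚ) ℚᵘ.≃ mkℚᵘ (z ℤ.- + 2) 1
half-minus-one z = begin
  ℚ.toℚᵘ (z ℚ./ 2 ℚ.- 1ℚ)                  ≈⟨ ℚ.toℚᵘ-homo-+ (z ℚ./ 2) (ℚ.- 1ℚ) ⟩
  ℚ.toℚᵘ (z ℚ./ 2) ℚᵘ.+ mkℚᵘ -[1+ 0 ] 0     ≈⟨ ℚᵘ.+-congˡ (mkℚᵘ -[1+ 0 ] 0) (toℚᵘ-/ z 1) ⟩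
  mkℚᵘ z 1 ℚᵘ.+ mkℚᵘ -[1+ 0 ] 0             ≈⟨ *≡* (cross z) ⟩
  mkℚᵘ (z ℤ.- + 2) 1                        ∎
  where
  open ℚᵘ.≃-Reasoning
  cross : ∀ z → (z ℤ.* + 1 ℤ.+ -[1+ 0 ] ℤ.* + 2) ℤ.* + 2 ≡ (z ℤ.- + 2) ℤ.* (+ 2 ℤ.* + 1)
  cross = solve-∀

-- ceiling reads off the normalised fraction, so its argument is first
-- rewritten as an explicit mkℚ.
ceiling-mkℚ⁺ : ∀ n d .{c : Coprime (suc n) (suc d)} → ceiling (mkℚ (+ suc n) d c) ≡ ℤ.- (-[1+ n ] ℤ./ℕ suc d)
ceiling-mkℚ⁺ n d = cong ℤ.-_ (div-pos-is-/ℕ -[1+ n ] (suc d))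

ceiling-half : ∀ {k} → Halves k → ceiling ((+ suc k) ℚ./ 2 ℚ.- 1ℚ) ≡ + ⌊ k /2⌋
ceiling-half (even zero)    = refl
ceiling-half (even (suc t)) = begin
  ceiling ((+ suc (suc t ℕ.+ suc t)) ℚ./ 2 ℚ.- 1ℚ)  ≡⟨ cong ceiling as-mkℚ ⟩
  ceiling (mkℚ (+ suc (t ℕ.+ t)) 1 (odd-coprime-2 t)) ≡⟨ ceiling-mkℚ⁺ (t ℕ.+ t) 1 {odd-coprime-2 t} ⟩
  ℤ.- (-[1+ t ℕ.+ t ] ℤ./ℕ 2)                         ≡⟨ cong (λ x → ℤ.- (x ℤ./ℕ 2)) (split (+ t)) ⟩
  ℤ.- ((+ 1 ℤ.+ -[1+ t ] ℤ.* + 2) ℤ./ℕ 2)            ≡⟨ cong ℤ.-_ ([r+qn]/ℕn≡q 2 1 -[1+ t ] (ℕ.s≤s (ℕ.s≤s ℕ.z≤n))) ⟩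
  + suc t                                              ≡⟨ cong +_ (ℕ.n≡⌊n+n/2⌋ (suc t)) ⟩
  + ⌊ suc t ℕ.+ suc t /2⌋                              ∎
  where
  open ≡-Reasoning
  cross : ∀ T → ((+ 1 ℤ.+ (+ 1 ℤ.+ T ℤ.+ (+ 1 ℤ.+ T))) ℤ.- + 2) ℤ.* + 2 ≡ (+ 1 ℤ.+ (T ℤ.+ T)) ℤ.* + 2
  cross = solve-∀
  as-mkℚ : (+ suc (suc t ℕ.+ suc t)) ℚ./ 2 ℚ.- 1ℚ ≡ mkℚ (+ suc (t ℕ.+ t)) 1 (odd-coprime-2 t)
  as-mkℚ = ℚ.toℚᵘ-injective (ℚᵘ.≃-trans (half-minus-one (+ suc (suc t ℕ.+ suc t))) (*≡* (cross (+ t))))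
  split : ∀ T → ℤ.- (+ 1 ℤ.+ (T ℤ.+ T)) ≡ + 1 ℤ.+ ℤ.- (+ 1 ℤ.+ T) ℤ.* + 2
  split = solve-∀
ceiling-half (odd zero)     = refl
ceiling-half (odd (suc u))  = begin
  ceiling ((+ suc (suc (suc u ℕ.+ suc u))) ℚ./ 2 ℚ.- 1ℚ)  ≡⟨ cong ceiling as-mkℚ ⟩
  ceiling (mkℚ (+ suc u) 0 (Coprime.sym (Coprime.1-coprimeTo (suc u))))  ≡⟨ ceiling-mkℚ⁺ u 0 {Coprime.sym (Coprime.1-coprimeTo (suc u))} ⟩
  ℤ.- (-[1+ u ] ℤ./ℕ 1)                                  ≡⟨ cong (λ x → ℤ.- (x ℤ./ℕ 1)) (split (+ u)) ⟩
  ℤ.- ((+ 0 ℤ.+ -[1+ u ] ℤ.* + 1) ℤ./ℕ 1)               ≡⟨ cong ℤ.-_ ([r+qn]/ℕn≡q 1 0 -[1+ u ] (ℕ.s≤s ℕ.z≤n)) ⟩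
  + suc u                                                 ≡⟨ cong +_ (⌊suc[h+h]/2⌋≡h (suc u)) ⟨
  + ⌊ suc (suc u ℕ.+ suc u) /2⌋                           ∎
  where
  open ≡-Reasoning
  cross : ∀ U → ((+ 1 ℤ.+ (+ 1 ℤ.+ (+ 1 ℤ.+ U ℤ.+ (+ 1 ℤ.+ U)))) ℤ.- + 2) ℤ.* + 1 ≡ (+ 1 ℤ.+ U) ℤ.* (+ 2 ℤ.* + 1)
  cross = solve-∀
  as-mkℚ : (+ suc (suc (suc u ℕ.+ suc u))) ℚ./ 2 ℚ.- 1ℚ ≡ mkℚ (+ suc u) 0 (Coprime.sym (Coprime.1-coprimeTo (suc u)))
  as-mkℚ = ℚ.toℚᵘ-injective (ℚᵘ.≃-trans (half-minus-one (+ suc (suc (suc u ℕ.+ suc u)))) (*≡* (cross (+ u))))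
  split : ∀ U → ℤ.- (+ 1 ℤ.+ U) ≡ + 0 ℤ.+ ℤ.- (+ 1 ℤ.+ U) ℤ.* + 1
  split = solve-∀

3*powℤ[3,⌈n/2⌉-1] : ∀ n → toℚ (+ 3) ℚ.* powℤ 3 (ceiling ((+ n) ℚ./ 2 ℚ.- 1ℚ)) ≡ toℚ ((+ 3) ℤ.^ ⌈ n /2⌉)
3*powℤ[3,⌈n/2⌉-1] zero    = refl
3*powℤ[3,⌈n/2⌉-1] (suc k) = trans (cong (λ e → toℚ (+ 3) ℚ.* powℤ 3 e) (ceiling-half (halves k))) (pow-pred 3 ⌊ k /2⌋)

toℚ-signTable : ∀ r → toℚ (signTable r) ≡ (if r ≡ᵇ 0 then 1ℚ else ℚ.- 1ℚ)
toℚ-signTable zero    = refl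
toℚ-signTable (suc _) = refl

ωs : ℕ → Counts
ωs m c = ω c m

toℚ-*₃ : ∀ a b c → toℚ (a ℤ.* b ℤ.* c) ≡ toℚ a ℚ.* toℚ b ℚ.* toℚ c
toℚ-*₃ a b c = trans (toℚ-* (a ℤ.* b) c) (cong (ℚ._* toℚ c) (toℚ-* a b))

toℚ-+₃ : ∀ a b c → toℚ (a ℤ.+ b ℤ.+ c) ≡ toℚ a ℚ.+ toℚ b ℚ.+ toℚ c
toℚ-+₃ a b c = trans (toℚ-+ (a ℤ.+ b) c) (cong (ℚ._+ toℚ c) (toℚ-+ a b))

six-RHS : ∀ m j → toℚ (+ 6) ℚ.* RHS m j ≡ toℚ (term₁ (ωs m) j ℤ.+ term₂ (ωs m) j ℤ.+ term₃ (ωs m) j)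
six-RHS m j = begin
  toℚ (+ 6) ℚ.* (P2 ℚ.* P3 ℚ.* V1 ℚ.+ Z3 ℚ.* ½ ℚ.* P3′ ℚ.* V2 ℚ.+ Zs ℚ.* S ℚ.* ⅓ ℚ.* P2′)
    ≡⟨ distrib₃ (P2 ℚ.* P3 ℚ.* V1) (Z3 ℚ.* ½ ℚ.* P3′ ℚ.* V2) (Zs ℚ.* S ℚ.* ⅓ ℚ.* P2′) ⟩
  toℚ (+ 6) ℚ.* (P2 ℚ.* P3 ℚ.* V1) ℚ.+ toℚ (+ 6) ℚ.* (Z3 ℚ.* ½ ℚ.* P3′ ℚ.* V2) ℚ.+ toℚ (+ 6) ℚ.* (Zs ℚ.* S ℚ.* ⅓ ℚ.* P2′)
    ≡⟨ cong₂ ℚ._+_ (cong₂ ℚ._+_ (split₁ P2 P3 V1) (split₂ Z3 P3′ V2)) (split₃ Zs S P2′) ⟩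
  (2ℚ ℚ.* P2) ℚ.* (3ℚ ℚ.* P3) ℚ.* V1 ℚ.+ Z3 ℚ.* (3ℚ ℚ.* P3′) ℚ.* V2 ℚ.+ Zs ℚ.* (2ℚ ℚ.* P2′) ℚ.* S
    ≡⟨ cong₂ ℚ._+_ (cong₂ ℚ._+_ (cong₂ (λ x y → x ℚ.* y ℚ.* V1) (2*powℤ[2,n-1] (w 3)) (3*powℤ[3,⌈n/2⌉-1] (w 2 ℕ.+ w 4)))
                              (cong₂ (λ x y → x ℚ.* y ℚ.* V2) (toℚ-^ (+ 0) (w 3)) (3*powℤ[3,⌈n/2⌉-1] (total w))))
                   (cong₂ (λ x y → x ℚ.* y ℚ.* S) (toℚ-^ (+ 0) (w 2 ℕ.+ w 4)) (2*powℤ[2,n-1] (total w))) ⟩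
  toℚ K₁ ℚ.* toℚ L₁ ℚ.* V1 ℚ.+ toℚ K₂ ℚ.* toℚ L₂ ℚ.* V2 ℚ.+ toℚ K₃ ℚ.* toℚ L₃ ℚ.* S
    ≡⟨ cong (λ x → toℚ K₁ ℚ.* toℚ L₁ ℚ.* V1 ℚ.+ toℚ K₂ ℚ.* toℚ L₂ ℚ.* V2 ℚ.+ toℚ K₃ ℚ.* toℚ L₃ ℚ.* x)
            (sym (toℚ-signTable (j %ℕ 2))) ⟩
  toℚ K₁ ℚ.* toℚ L₁ ℚ.* V1 ℚ.+ toℚ K₂ ℚ.* toℚ L₂ ℚ.* V2 ℚ.+ toℚ K₃ ℚ.* toℚ L₃ ℚ.* toℚ (sign j)
    ≡⟨ cong₂ ℚ._+_ (cong₂ ℚ._+_ (toℚ-*₃ K₁ L₁ _) (toℚ-*₃ K₂ L₂ _)) (toℚ-*₃ K₃ L₃ _) ⟨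
  toℚ (term₁ w j) ℚ.+ toℚ (term₂ w j) ℚ.+ toℚ (term₃ w j)
    ≡⟨ toℚ-+₃ (term₁ w j) (term₂ w j) (term₃ w j) ⟨
  toℚ (term₁ w j ℤ.+ term₂ w j ℤ.+ term₃ w j)
    ∎
  where
  open ≡-Reasoning
  open ℚ-Solver.+-*-Solver
  w = ωs m
  2ℚ 3ℚ ½ ⅓ : ℚ
  2ℚ = toℚ (+ 2)
  3ℚ = toℚ (+ 3)
  ½ = (+ 1) ℚ./ 2
  ⅓ = (+ 1) ℚ./ 3
  P2 = powℤ 2 (+ w 3 ℤ.- + 1)
  P3 = powℤ 3 (ceiling ((+ (w 2 ℕ.+ w 4)) ℚ./ 2 ℚ.- 1ℚ))
  P3′ = powℤ 3 (ceiling ((+ total w) ℚ./ 2 ℚ.- 1ℚ))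
  P2′ = powℤ 2 (+ total w ℤ.- + 1)
  Z3 = 0ℚ ^ℚ w 3
  Zs = 0ℚ ^ℚ (w 2 ℕ.+ w 4)
  V1 = toℚ (v (αphase w j))
  V2 = toℚ (v (aphase w j))
  S = signPow j
  K₁ = (+ 2) ℤ.^ w 3
  L₁ = (+ 3) ℤ.^ ⌈ w 2 ℕ.+ w 4 /2⌉
  K₂ = (+ 0) ℤ.^ w 3
  L₂ = (+ 3) ℤ.^ ⌈ total w /2⌉
  K₃ = (+ 0) ℤ.^ (w 2 ℕ.+ w 4)
  L₃ = (+ 2) ℤ.^ total w
  distrib₃ : ∀ a b c → toℚ (+ 6) ℚ.* (a ℚ.+ b ℚ.+ c) ≡ toℚ (+ 6) ℚ.* a ℚ.+ toℚ (+ 6) ℚ.* b ℚ.+ toℚ (+ 6) ℚ.* c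
  distrib₃ = solve 3 (λ a b c → con (toℚ (+ 6)) :* (a :+ b :+ c) := con (toℚ (+ 6)) :* a :+ con (toℚ (+ 6)) :* b :+ con (toℚ (+ 6)) :* c) refl
  split₁ : ∀ a b c → toℚ (+ 6) ℚ.* (a ℚ.* b ℚ.* c) ≡ (2ℚ ℚ.* a) ℚ.* (3ℚ ℚ.* b) ℚ.* c
  split₁ = solve 3 (λ a b c → con (toℚ (+ 6)) :* (a :* b :* c) := (con 2ℚ :* a) :* (con 3ℚ :* b) :* c) refl
  split₂ : ∀ z a c → toℚ (+ 6) ℚ.* (z ℚ.* ½ ℚ.* a ℚ.* c) ≡ z ℚ.* (3ℚ ℚ.* a) ℚ.* c
  split₂ = solve 3 (λ z a c → con (toℚ (+ 6)) :* (z :* con ½ :* a :* c) := z :* (con 3ℚ :* a) :* c) refl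
  split₃ : ∀ z s a → toℚ (+ 6) ℚ.* (z ℚ.* s ℚ.* ⅓ ℚ.* a) ≡ z ℚ.* (2ℚ ℚ.* a) ℚ.* s
  split₃ = solve 3 (λ z s a → con (toℚ (+ 6)) :* (z :* s :* con ⅓ :* a) := z :* (con 2ℚ :* a) :* s) refl

cancel-6 : ∀ {x y} → toℚ (+ 6) ℚ.* x ≡ toℚ (+ 6) ℚ.* y → x ≡ y
cancel-6 {x} {y} eq = trans (sym (sixth x)) (trans (cong ((+ 1 ℚ./ 6) ℚ.*_) eq) (sixth y))
  where
  sixth : ∀ z → (+ 1 ℚ./ 6) ℚ.* (toℚ (+ 6) ℚ.* z) ≡ z
  sixth z = trans (sym (ℚ.*-assoc (+ 1 ℚ./ 6) (toℚ (+ 6)) z)) (ℚ.*-identityˡ z)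

lemma2 : (m : ℕ) → 0 < m → ¬ (2 ∣ m) → m ≢ 1 → ¬ (31 ∣ m)
         → (∀ p → p ∣ m → ¬ InP 0 p)
         → (j : ℤ) → toℚ (T m j) ≡ RHS m j
lemma2 m m>0 2∤m m≢1 31∤m no-P₀ j = cancel-6 (begin
  toℚ (+ 6) ℚ.* toℚ (classSum (product ps) j)                ≡⟨ toℚ-* (+ 6) (classSum (product ps) j) ⟨
  toℚ (+ 6 ℤ.* classSum (product ps) j)                      ≡⟨ cong toℚ (six-classSum ps (primeDivisors-unique m) ps-good j) ⟩
  toℚ (sixT (ωs m) j)                                         ≡⟨ cong toℚ (sixT-nonempty (ωs m) j W≢0) ⟩
  toℚ (term₁ (ωs m) j ℤ.+ term₂ (ωs m) j ℤ.+ term₃ (ωs m) j) ≡⟨ six-RHS m j ⟨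
  toℚ (+ 6) ℚ.* RHS m j                                       ∎)
  where
  open ≡-Reasoning
  instance _ = ℕ.>-nonZero m>0
  ps = primeDivisors m
  ps-good = primeDivisors-good m 2∤m 31∤m no-P₀
  W≢0 : total (ωs m) ≢ 0
  W≢0 W≡0 with prime-factor m m≢1
  ... | q , q-prime , q∣m = ∈⇒length≢0 (∈-primeDivisors⁺ q-prime q∣m) (trans (sym (total-counts ps ps-good)) W≡0)
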